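{- If $G\ne K_5$ is a $5$-Ore graph, then $T(G)\ge 2+\frac{|V(G)|-1}{4}$.
   Context: All graphs are finite and simple. An Ore-composition of $G_1$ and $G_2$: delete an edge $xy$ of $G_1$, split a vertex $z$ of $G_2$ into two vertices $z_1,z_2$ of positive degree, and identify $x$ with $z_1$ and $y$ with $z_2$. A graph is $5$-Ore if obtainable from copies of $K_5$ by repeated Ore-compositions. $T(G)$ is the maximum, over subgraphs $H$ of $G$ that are vertex-disjoint unions of cliques of size three or four, of the number of components of $H$ that are $K_3$ plus twice the number of components that are $K_4$. -}

module Defs where

open import Data.Nat using (ℕ; _+_; _*_; _≤_)
open import Data.Fin using (Fin)
open import Data.Bool using (Bool; true; false)
open import Data.List using (List; []; _∷_; map; concatMap)
open import Data.Nat.ListAction using (sum)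
open import Data.List.Relation.Unary.All using (All)
open import Data.List.Relation.Unary.Unique.Propositional using (Unique)
open import Data.Product using (Σ; _×_; ∃; ∃-syntax)
open import Data.Sum using (_⊎_)
open import Data.Unit using (⊤)
open import Relation.Binary.PropositionalEquality using (_≡_; _≢_)
open import Relation.Nullary using (¬_)

record Graph (n : ℕ) : Set where
  field
    adj    : Fin n → Fin n → Bool
    sym    : ∀ u v → adj u v ≡ adj v u
    irrefl : ∀ v → adj v v ≡ false
open Graph public

Complete : ∀ {n} → Graph n → Set
Complete G = ∀ u v → u ≢ v → adj G u v ≡ true

IsK5 : ∀ {n} → Graph n → Set
IsK5 {n} G = (n ≡ 5) × Complete G

-- G is an Ore-composition of G1 and G2 (with an arbitrary labelling of the
-- vertices of G): φ embeds V(G1), ψ embeds V(G2) - {z}; the edge xy of G1 is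
-- deleted, z is split into z1 = φ x and z2 = φ y, each of positive degree,
-- the edges at z being partitioned between z1 and z2.
record OreComp {n₁ n₂ n : ℕ} (G₁ : Graph n₁) (G₂ : Graph n₂) (G : Graph n) : Set where
  field
    x y    : Fin n₁
    xy     : adj G₁ x y ≡ true
    z      : Fin n₂
    φ      : Fin n₁ → Fin n
    ψ      : Fin n₂ → Fin n
    φ-inj  : ∀ u u' → φ u ≡ φ u' → u ≡ u'
    ψ-inj  : ∀ w w' → w ≢ z → w' ≢ z → ψ w ≡ ψ w' → w ≡ w'
    disj   : ∀ u w → w ≢ z → φ u ≢ ψ w
    cover  : ∀ v → (∃[ u ] φ u ≡ v) ⊎ (∃[ w ] (w ≢ z × ψ w ≡ v))
    adj-xy : adj G (φ x) (φ y) ≡ false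
    adj-11 : ∀ u u' → ¬ (u ≡ x × u' ≡ y) → ¬ (u ≡ y × u' ≡ x) →
             adj G (φ u) (φ u') ≡ adj G₁ u u'
    adj-22 : ∀ w w' → w ≢ z → w' ≢ z → adj G (ψ w) (ψ w') ≡ adj G₂ w w'
    adj-12 : ∀ u w → w ≢ z → u ≢ x → u ≢ y → adj G (φ u) (ψ w) ≡ false
    split-nbr  : ∀ w → w ≢ z → adj G₂ z w ≡ true →
                 (adj G (φ x) (ψ w) ≡ true × adj G (φ y) (ψ w) ≡ false) ⊎
                 (adj G (φ x) (ψ w) ≡ false × adj G (φ y) (ψ w) ≡ true)
    split-non  : ∀ w → w ≢ z → adj G₂ z w ≡ false →
                 (adj G (φ x) (ψ w) ≡ false × adj G (φ y) (ψ w) ≡ false)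
    pos-x  : ∃[ w ] (w ≢ z × adj G (φ x) (ψ w) ≡ true)
    pos-y  : ∃[ w ] (w ≢ z × adj G (φ y) (ψ w) ≡ true)

data Ore5 : (n : ℕ) → Graph n → Set where
  k5  : (G : Graph 5) → Complete G → Ore5 5 G
  ore : ∀ {n₁ n₂ n} {G₁ : Graph n₁} {G₂ : Graph n₂} {G : Graph n} →
        Ore5 n₁ G₁ → Ore5 n₂ G₂ → OreComp G₁ G₂ G → Ore5 n G

data Clique (n : ℕ) : Set where
  tri  : Fin n → Fin n → Fin n → Clique n
  quad : Fin n → Fin n → Fin n → Fin n → Clique n

verts : ∀ {n} → Clique n → List (Fin n)
verts (tri a b c)    = a ∷ b ∷ c ∷ []
verts (quad a b c d) = a ∷ b ∷ c ∷ d ∷ []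

weight : ∀ {n} → Clique n → ℕ
weight (tri _ _ _)    = 1
weight (quad _ _ _ _) = 2

PairwiseAdj : ∀ {n} → Graph n → List (Fin n) → Set
PairwiseAdj G []       = ⊤
PairwiseAdj G (v ∷ vs) = All (λ u → adj G v u ≡ true) vs × PairwiseAdj G vs

-- A subgraph of G that is a vertex-disjoint union of K3's and K4's.
IsPacking : ∀ {n} → Graph n → List (Clique n) → Set
IsPacking G cs = All (λ c → PairwiseAdj G (verts c)) cs × Unique (concatMap verts cs)

value : ∀ {n} → List (Clique n) → ℕ
value cs = sum (map weight cs)

IsT : ∀ {n} → Graph n → ℕ → Set
IsT G t = (∃[ cs ] (IsPacking G cs × value cs ≡ t)) ×
          (∀ cs → IsPacking G cs → value cs ≤ t)

module Submission where

open import Defs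
open import Data.Nat using (ℕ; _+_; _*_; _≤_)
open import Relation.Nullary using (¬_)

open import Algebra.Properties.CommutativeSemigroup using (interchange)
open import Data.Nat using (suc; z≤n)
open import Data.Nat.Properties
  using (≤-refl; ≤-trans; +-mono-≤; *-monoʳ-≤; *-distribˡ-+; *-suc; +-suc; +-comm; +-assoc;
         +-cancelˡ-≤; +-commutativeSemigroup; module ≤-Reasoning)
open import Data.Nat.ListAction using (sum)
open import Data.Nat.ListAction.Properties using (sum-++)
open import Data.Fin using (Fin; zero; suc; join; splitAt; punchIn; _≟_)
open import Data.Fin.Properties using (injective⇒≤; splitAt-join; punchIn-injective; punchInᵢ≢i)
open import Data.List using (List; []; _∷_; _++_; map; concatMap; allFin)
open import Data.List.Properties using (map-++; concatMap-++; ++-identityʳ)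
open import Data.List.Relation.Unary.All as All using (All; []; _∷_)
open import Data.List.Relation.Unary.All.Properties as Allₚ using (¬Any⇒All¬; All¬⇒¬Any)
open import Data.List.Relation.Unary.AllPairs as AllPairs using (AllPairs; []; _∷_)
open import Data.List.Relation.Unary.Any using (here; there; any?)
open import Data.List.Relation.Unary.Unique.Propositional using (Unique)
import Data.List.Relation.Unary.Unique.Propositional.Properties as Uniqueₚ
open import Data.List.Relation.Binary.Disjoint.Propositional using (Disjoint)
open import Data.List.Relation.Binary.Subset.Propositional using (_⊆_)
import Data.List.Relation.Binary.Subset.Propositional.Properties as Subsetₚ
open import Data.List.Membership.Propositional using (_∈_; _∉_)
open import Data.List.Membership.Propositional.Properties using (∈-map⁻; ∈-++⁻)
open import Data.Product using (_×_; _,_; ∃-syntax)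
open import Data.Sum using (_⊎_; inj₁; inj₂; [_,_]′)
open import Data.Unit using (tt)
open import Data.Bool using (true)
open import Data.Empty using (⊥-elim)
open import Relation.Nullary using (yes; no)
open import Relation.Binary.PropositionalEquality as ≡
  using (_≡_; _≢_; refl; trans; cong; cong₂; subst; subst₂; ≢-sym)

-- We prove,
-- by induction on the Ore-construction, the stronger statement that for every
-- 5-Ore graph G on n vertices and every vertex y there is a packing avoiding y
-- of value v with n + 3 ≤ 4v:
--   * for K5, the K4 on the four vertices other than y has value 2;
--   * for an Ore-composition of G₁ (edge xy deleted) and G₂ (vertex z split),
--     the induction hypotheses give packings of G₁ - y and G₂ - z; they embed
--     disjointly into G, and since n + 1 ≤ n₁ + n₂ their union has a value v
--     with n + 7 ≤ 4v.  Deleting any vertex y from a packing costs at most one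
--     unit of value (a triangle is dropped, a K4 shrinks to a triangle), which
--     restores the invariant n + 3 ≤ 4v.
-- The theorem is the intermediate bound n + 7 ≤ 4v for an Ore-composition,
-- combined with the maximality of T(G).

Adjacent : ∀ {n} → Graph n → Fin n → Fin n → Set
Adjacent G u v = adj G u v ≡ true

adjacent⇒≢ : ∀ {n} (G : Graph n) {u v} → Adjacent G u v → u ≢ v
adjacent⇒≢ G {u} uv refl with trans (≡.sym uv) (irrefl G u)
... | ()

adjacent-sym : ∀ {n} (G : Graph n) {u v} → Adjacent G u v → Adjacent G v u
adjacent-sym G {u} {v} uv = trans (sym G v u) uv

adjacent⇒∉ : ∀ {n} (G : Graph n) {y vs} → All (Adjacent G y) vs → y ∉ vs
adjacent⇒∉ G adjacent = All¬⇒¬Any (All.map (adjacent⇒≢ G) adjacent)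

pairwise⇒allPairs : ∀ {n} (G : Graph n) {vs} → PairwiseAdj G vs → AllPairs (Adjacent G) vs
pairwise⇒allPairs G {[]}     _       = []
pairwise⇒allPairs G {v ∷ vs} (a , p) = a ∷ pairwise⇒allPairs G p

allPairs⇒pairwise : ∀ {n} (G : Graph n) {vs} → AllPairs (Adjacent G) vs → PairwiseAdj G vs
allPairs⇒pairwise G []      = tt
allPairs⇒pairwise G (a ∷ p) = a , allPairs⇒pairwise G p

allPairs-map-on : ∀ {A B : Set} {P : A → Set} {R : A → A → Set} {S : B → B → Set} (f : A → B) →
                  (∀ {a b} → P a → P b → R a b → S (f a) (f b)) →
                  ∀ {xs} → All P xs → AllPairs R xs → AllPairs S (map f xs)
allPairs-map-on f preserve []       []       = []
allPairs-map-on f preserve (p ∷ ps) (r ∷ rs) =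
  Allₚ.map⁺ (All.zipWith (λ (q , s) → preserve p q s) (ps , r)) ∷ allPairs-map-on f preserve ps rs

unique-++⁻ : ∀ {A : Set} (xs : List A) {ys} → Unique (xs ++ ys) → Unique xs × Unique ys × Disjoint xs ys
unique-++⁻ []       u        = [] , u , λ ()
unique-++⁻ (x ∷ xs) (x∉ ∷ u) with unique-++⁻ xs u
... | uxs , uys , disjoint = Allₚ.++⁻ˡ xs x∉ ∷ uxs , uys , separate
  where
  separate : Disjoint (x ∷ xs) _
  separate (here refl  , v∈ys) = All.lookup (Allₚ.++⁻ʳ xs x∉) v∈ys refl
  separate (there v∈xs , v∈ys) = disjoint (v∈xs , v∈ys)

V : ∀ {n} → List (Clique n) → List (Fin n)
V cs = concatMap verts cs

IsClique : ∀ {n} → Graph n → Clique n → Set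
IsClique G k = PairwiseAdj G (verts k)

V-++ : ∀ {n} (xs ys : List (Clique n)) → V (xs ++ ys) ≡ V xs ++ V ys
V-++ = concatMap-++ verts

value-++ : ∀ {n} (xs ys : List (Clique n)) → value (xs ++ ys) ≡ value xs + value ys
value-++ xs ys = trans (cong sum (map-++ weight xs ys)) (sum-++ (map weight xs) (map weight ys))

cliquePacking : ∀ {n} (G : Graph n) (k : Clique n) → IsClique G k → IsPacking G (k ∷ [])
cliquePacking G k clique =
  clique ∷ [] ,
  subst Unique (≡.sym (++-identityʳ (verts k))) (AllPairs.map (adjacent⇒≢ G) (pairwise⇒allPairs G clique))

packing-++ : ∀ {n} {G : Graph n} {xs ys} → IsPacking G xs → IsPacking G ys →
             Disjoint (V xs) (V ys) → IsPacking G (xs ++ ys)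
packing-++ {xs = xs} {ys} (cliques₁ , unique₁) (cliques₂ , unique₂) disjoint =
  Allₚ.++⁺ cliques₁ cliques₂ ,
  subst Unique (≡.sym (V-++ xs ys)) (Uniqueₚ.++⁺ unique₁ unique₂ disjoint)

packing-++⁻ : ∀ {n} {G : Graph n} xs {ys} → IsPacking G (xs ++ ys) →
              IsPacking G xs × IsPacking G ys × Disjoint (V xs) (V ys)
packing-++⁻ xs {ys} (cliques , unique) with unique-++⁻ (V xs) (subst Unique (V-++ xs ys) unique)
... | unique₁ , unique₂ , disjoint =
  (Allₚ.++⁻ˡ xs cliques , unique₁) , (Allₚ.++⁻ʳ xs cliques , unique₂) , disjoint

record Deletion {n} (G : Graph n) (y : Fin n) (loss : ℕ) (cs : List (Clique n)) : Set where
  field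
    remaining : List (Clique n)
    packing   : IsPacking G remaining
    avoids    : y ∉ V remaining
    within    : V remaining ⊆ V cs
    bounded   : value cs ≤ loss + value remaining
open Deletion

untouched : ∀ {n} {G : Graph n} {y cs} → IsPacking G cs → y ∉ V cs → Deletion G y 0 cs
untouched {cs = cs} P y∉ =
  record { remaining = cs ; packing = P ; avoids = y∉ ; within = λ v∈ → v∈ ; bounded = ≤-refl }

deletion-++ : ∀ {n} {G : Graph n} {y ℓ ℓ′ xs ys} → Disjoint (V xs) (V ys) →
              Deletion G y ℓ xs → Deletion G y ℓ′ ys → Deletion G y (ℓ + ℓ′) (xs ++ ys)
deletion-++ {y = y} {ℓ} {ℓ′} {xs} {ys} disjoint Dx Dy = record
  { remaining = rx ++ ry
  ; packing   = packing-++ (packing Dx) (packing Dy)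
                  (λ (v∈x , v∈y) → disjoint (within Dx v∈x , within Dy v∈y))
  ; avoids    = subst (y ∉_) (≡.sym (V-++ rx ry))
                  (λ y∈ → [ avoids Dx , avoids Dy ]′ (∈-++⁻ (V rx) y∈))
  ; within    = subst₂ _⊆_ (≡.sym (V-++ rx ry)) (≡.sym (V-++ xs ys)) (Subsetₚ.++⁺ (within Dx) (within Dy))
  ; bounded   = begin
      value (xs ++ ys)                   ≡⟨ value-++ xs ys ⟩
      value xs + value ys                ≤⟨ +-mono-≤ (bounded Dx) (bounded Dy) ⟩
      (ℓ + value rx) + (ℓ′ + value ry)   ≡⟨ interchange +-commutativeSemigroup ℓ (value rx) ℓ′ (value ry) ⟩
      (ℓ + ℓ′) + (value rx + value ry)   ≡⟨ cong (ℓ + ℓ′ +_) (≡.sym (value-++ rx ry)) ⟩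
      (ℓ + ℓ′) + value (rx ++ ry)        ∎ }
  where
  open ≤-Reasoning
  rx ry : List (Clique _)
  rx = remaining Dx
  ry = remaining Dy

k4Triangle : ∀ {n} (G : Graph n) {y a b c d p q r} →
             Adjacent G p q → Adjacent G p r → Adjacent G q r →
             All (Adjacent G y) (p ∷ q ∷ r ∷ []) → p ∷ q ∷ r ∷ [] ⊆ a ∷ b ∷ c ∷ d ∷ [] →
             Deletion G y 1 (quad a b c d ∷ [])
k4Triangle G {p = p} {q} {r} pq pr qr yAdjacent sub = record
  { remaining = tri p q r ∷ []
  ; packing   = cliquePacking G (tri p q r) ((pq ∷ pr ∷ []) , (qr ∷ []) , [] , tt)
  ; avoids    = adjacent⇒∉ G yAdjacent
  ; within    = sub
  ; bounded   = ≤-refl }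

cliqueDeletion : ∀ {n} (G : Graph n) {y} (k : Clique n) → IsClique G k → y ∈ V (k ∷ []) →
                 Deletion G y 1 (k ∷ [])
cliqueDeletion G (tri _ _ _) _ _ =
  record { remaining = [] ; packing = [] , [] ; avoids = λ () ; within = λ () ; bounded = ≤-refl }
cliqueDeletion G (quad a b c d) ((ab ∷ ac ∷ ad ∷ []) , (bc ∷ bd ∷ []) , (cd ∷ []) , [] , tt) =
  let ba = adjacent-sym G ab ; ca = adjacent-sym G ac ; cb = adjacent-sym G bc
      da = adjacent-sym G ad ; db = adjacent-sym G bd ; dc = adjacent-sym G cd
  in λ where
  (here refl) →
    k4Triangle G bc bd cd (ab ∷ ac ∷ ad ∷ []) there
  (there (here refl)) →
    k4Triangle G ac ad cd (ba ∷ bc ∷ bd ∷ []) (Subsetₚ.∷⁺ʳ a there)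
  (there (there (here refl))) →
    k4Triangle G ab ad bd (ca ∷ cb ∷ cd ∷ []) (Subsetₚ.∷⁺ʳ a (Subsetₚ.∷⁺ʳ b there))
  (there (there (there (here refl)))) →
    k4Triangle G ab ac bc (da ∷ db ∷ dc ∷ []) (Subsetₚ.xs⊆xs++ys (a ∷ b ∷ c ∷ []) (d ∷ []))

-- Any vertex can be deleted from a packing at the cost of one unit of value:
-- only the (unique) clique containing it is affected.
deleteVertex : ∀ {n} (G : Graph n) (y : Fin n) (cs : List (Clique n)) → IsPacking G cs → Deletion G y 1 cs
deleteVertex G y [] _ =
  record { remaining = [] ; packing = [] , [] ; avoids = λ () ; within = λ () ; bounded = z≤n }
deleteVertex G y (k ∷ cs) P with packing-++⁻ (k ∷ []) P | any? (y ≟_) (V (k ∷ []))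
... | (clique ∷ [] , _) , Pcs , disjoint | yes y∈k =
  deletion-++ disjoint (cliqueDeletion G k clique y∈k) (untouched Pcs (λ y∈cs → disjoint (y∈k , y∈cs)))
... | Pk , Pcs , disjoint | no y∉k =
  deletion-++ disjoint (untouched Pk y∉k) (deleteVertex G y cs Pcs)

mapC : ∀ {m n} → (Fin m → Fin n) → Clique m → Clique n
mapC f (tri a b c)    = tri (f a) (f b) (f c)
mapC f (quad a b c d) = quad (f a) (f b) (f c) (f d)

V-mapC : ∀ {m n} (f : Fin m → Fin n) (cs : List (Clique m)) → V (map (mapC f) cs) ≡ map f (V cs)
V-mapC f []                   = refl
V-mapC f (tri a b c ∷ cs)     = cong (λ vs → f a ∷ f b ∷ f c ∷ vs) (V-mapC f cs)
V-mapC f (quad a b c d ∷ cs)  = cong (λ vs → f a ∷ f b ∷ f c ∷ f d ∷ vs) (V-mapC f cs)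

value-mapC : ∀ {m n} (f : Fin m → Fin n) (cs : List (Clique m)) → value (map (mapC f) cs) ≡ value cs
value-mapC f []                  = refl
value-mapC f (tri _ _ _ ∷ cs)    = cong (1 +_) (value-mapC f cs)
value-mapC f (quad _ _ _ _ ∷ cs) = cong (2 +_) (value-mapC f cs)

record EmbeddingOn {m n} (H : Graph m) (G : Graph n) (Ok : Fin m → Set) : Set where
  field
    embed     : Fin m → Fin n
    injective : ∀ {u v} → Ok u → Ok v → embed u ≡ embed v → u ≡ v
    preserves : ∀ {u v} → Ok u → Ok v → Adjacent H u v → Adjacent G (embed u) (embed v)

transport : ∀ {m n} {H : Graph m} {G : Graph n} {Ok : Fin m → Set} (e : EmbeddingOn H G Ok) →
            ∀ {cs} → All Ok (V cs) → IsPacking H cs → IsPacking G (map (mapC (EmbeddingOn.embed e)) cs)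
transport {H = H} {G} {Ok} e {cs} ok (cliques , unique) =
  embedCliques cs ok cliques ,
  subst Unique (≡.sym (V-mapC embed cs))
    (allPairs-map-on embed (λ okᵤ okᵥ u≢v same → u≢v (injective okᵤ okᵥ same)) ok unique)
  where
  open EmbeddingOn e
  embedPairwise : ∀ {vs} → All Ok vs → PairwiseAdj H vs → PairwiseAdj G (map embed vs)
  embedPairwise ok clique = allPairs⇒pairwise G (allPairs-map-on embed preserves ok (pairwise⇒allPairs H clique))
  embedClique : ∀ k → All Ok (verts k) → IsClique H k → IsClique G (mapC embed k)
  embedClique (tri _ _ _)    = embedPairwise
  embedClique (quad _ _ _ _) = embedPairwise
  embedCliques : ∀ cs → All Ok (V cs) → All (IsClique H) cs → All (IsClique G) (map (mapC embed) cs)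
  embedCliques []       _  []       = []
  embedCliques (k ∷ cs) ok (c ∷ cl) =
    embedClique k (Allₚ.++⁻ˡ (verts k) ok) c ∷ embedCliques cs (Allₚ.++⁻ʳ (verts k) ok) cl

record AvoidingPacking {n} (G : Graph n) (y : Fin n) : Set where
  field
    cliques : List (Clique n)
    packing : IsPacking G cliques
    avoids  : y ∉ V cliques
    bound   : n + 3 ≤ 4 * value cliques

-- A packing of value v with n + 7 ≤ 4v, i.e. v ≥ 2 + (n - 1)/4.
record LargePacking {n} (G : Graph n) : Set where
  field
    cliques : List (Clique n)
    packing : IsPacking G cliques
    bound   : n + 7 ≤ 4 * value cliques

k5Avoiding : (G : Graph 5) → Complete G → ∀ y → AvoidingPacking G y
k5Avoiding G complete y = record
  { cliques = k4 ∷ []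
  ; packing = cliquePacking G k4 (allPairs⇒pairwise G (AllPairs.map (λ {u} {v} → complete u v) distinct))
  ; avoids  = missesY
  ; bound   = ≤-refl }
  where
  k4 : Clique 5
  k4 = quad (punchIn y zero) (punchIn y (suc zero)) (punchIn y (suc (suc zero))) (punchIn y (suc (suc (suc zero))))
  distinct : Unique (map (punchIn y) (allFin 4))
  distinct = Uniqueₚ.map⁺ (punchIn-injective y _ _) (Uniqueₚ.allFin⁺ 4)
  missesY : y ∉ map (punchIn y) (allFin 4)
  missesY y∈ with ∈-map⁻ (punchIn y) y∈
  ... | i , _ , y≡ = punchInᵢ≢i y i (≡.sym y≡)

-- An Ore-composition has at least one vertex fewer than its two parts together:
-- every vertex comes from G₁ or from G₂ - z, so Fin (1 + n) injects into
-- Fin n₁ ⊎ Fin n₂ by sending 0 to z and each vertex to one of its origins.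
coverBound : ∀ {n₁ n₂ n} (φ : Fin n₁ → Fin n) (ψ : Fin n₂ → Fin n) (z : Fin n₂) →
             (∀ v → (∃[ u ] φ u ≡ v) ⊎ (∃[ w ] (w ≢ z × ψ w ≡ v))) → suc n ≤ n₁ + n₂
coverBound {n₁} {n₂} {n} φ ψ z cover = injective⇒≤ code-injective
  where
  Origin : Fin n → Set
  Origin v = (∃[ u ] φ u ≡ v) ⊎ (∃[ w ] (w ≢ z × ψ w ≡ v))

  origin : ∀ {v} → Origin v → Fin n₁ ⊎ Fin n₂
  origin (inj₁ (u , _)) = inj₁ u
  origin (inj₂ (w , _)) = inj₂ w

  origin-injective : ∀ {v v′} (o : Origin v) (o′ : Origin v′) → origin o ≡ origin o′ → v ≡ v′
  origin-injective (inj₁ (u , φu≡v)) (inj₁ (.u , φu≡v′)) refl = trans (≡.sym φu≡v) φu≡v′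
  origin-injective (inj₂ (w , _ , ψw≡v)) (inj₂ (.w , _ , ψw≡v′)) refl = trans (≡.sym ψw≡v) ψw≡v′

  origin≢z : ∀ {v} (o : Origin v) → origin o ≢ inj₂ z
  origin≢z (inj₂ (w , w≢z , _)) refl = w≢z refl

  join-injective : ∀ {i j : Fin n₁ ⊎ Fin n₂} → join n₁ n₂ i ≡ join n₁ n₂ j → i ≡ j
  join-injective {i} {j} eq =
    trans (≡.sym (splitAt-join n₁ n₂ i)) (trans (cong (splitAt n₁) eq) (splitAt-join n₁ n₂ j))

  code : Fin (suc n) → Fin (n₁ + n₂)
  code zero    = join n₁ n₂ (inj₂ z)
  code (suc v) = join n₁ n₂ (origin (cover v))

  code-injective : ∀ {i j} → code i ≡ code j → i ≡ j
  code-injective {zero}  {zero}  _  = refl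
  code-injective {zero}  {suc j} eq = ⊥-elim (origin≢z (cover j) (≡.sym (join-injective eq)))
  code-injective {suc i} {zero}  eq = ⊥-elim (origin≢z (cover i) (join-injective eq))
  code-injective {suc i} {suc j} eq = cong suc (origin-injective (cover i) (cover j) (join-injective eq))

afterDeletion : ∀ n v v′ → n + 7 ≤ 4 * v → v ≤ 1 + v′ → n + 3 ≤ 4 * v′
afterDeletion n v v′ large loss = +-cancelˡ-≤ 4 (n + 3) (4 * v′) (begin
  4 + (n + 3)  ≡⟨ +-comm 4 (n + 3) ⟩
  (n + 3) + 4  ≡⟨ +-assoc n 3 4 ⟩
  n + 7        ≤⟨ large ⟩
  4 * v        ≤⟨ *-monoʳ-≤ 4 loss ⟩
  4 * (1 + v′) ≡⟨ *-suc 4 v′ ⟩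
  4 + 4 * v′   ∎)
  where open ≤-Reasoning

combineBounds : ∀ n n₁ n₂ v₁ v₂ → suc n ≤ n₁ + n₂ → n₁ + 3 ≤ 4 * v₁ → n₂ + 3 ≤ 4 * v₂ →
                n + 7 ≤ 4 * (v₁ + v₂)
combineBounds n n₁ n₂ v₁ v₂ count bound₁ bound₂ = begin
  n + 7                   ≡⟨ +-suc n 6 ⟩
  suc n + 6               ≤⟨ +-mono-≤ count ≤-refl ⟩
  (n₁ + n₂) + (3 + 3)     ≡⟨ interchange +-commutativeSemigroup n₁ 3 n₂ 3 ⟨
  (n₁ + 3) + (n₂ + 3)     ≤⟨ +-mono-≤ bound₁ bound₂ ⟩
  4 * v₁ + 4 * v₂         ≡⟨ *-distribˡ-+ 4 v₁ v₂ ⟨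
  4 * (v₁ + v₂)           ∎
  where open ≤-Reasoning

avoidVertex : ∀ {n} {G : Graph n} → LargePacking G → ∀ y → AvoidingPacking G y
avoidVertex {n} {G} P y = record
  { cliques = remaining D
  ; packing = packing D
  ; avoids  = avoids D
  ; bound   = afterDeletion n _ _ (LargePacking.bound P) (bounded D) }
  where
  D : Deletion G y 1 (LargePacking.cliques P)
  D = deleteVertex G y (LargePacking.cliques P) (LargePacking.packing P)

orePacking : ∀ {n₁ n₂ n} {G₁ : Graph n₁} {G₂ : Graph n₂} {G : Graph n} (o : OreComp G₁ G₂ G) →
             AvoidingPacking G₁ (OreComp.y o) → AvoidingPacking G₂ (OreComp.z o) → LargePacking G
orePacking {n₁} {n₂} {n} {G₁} {G₂} {G} o P₁ P₂ = record
  { cliques = cs₁′ ++ cs₂′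
  ; packing = packing-++ (transport e₁ ok₁ packing₁) (transport e₂ ok₂ packing₂) separated
  ; bound   = subst (λ v → n + 7 ≤ 4 * v) (≡.sym total)
                (combineBounds n n₁ n₂ (value cs₁) (value cs₂) (coverBound φ ψ z cover) bound₁ bound₂) }
  where
  open OreComp o
  open AvoidingPacking P₁ renaming (cliques to cs₁; packing to packing₁; avoids to avoids₁; bound to bound₁)
  open AvoidingPacking P₂ renaming (cliques to cs₂; packing to packing₂; avoids to avoids₂; bound to bound₂)

  -- Away from y, no edge of G₁ was deleted; away from z, G₂ is unchanged.
  e₁ : EmbeddingOn G₁ G (y ≢_)
  e₁ = record
    { embed     = φ
    ; injective = λ _ _ → φ-inj _ _
    ; preserves = λ y≢u y≢u′ → trans (adj-11 _ _ (λ (_ , u′≡y) → y≢u′ (≡.sym u′≡y))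
                                                  (λ (u≡y , _) → y≢u (≡.sym u≡y))) }
  e₂ : EmbeddingOn G₂ G (z ≢_)
  e₂ = record
    { embed     = ψ
    ; injective = λ z≢w z≢w′ → ψ-inj _ _ (≢-sym z≢w) (≢-sym z≢w′)
    ; preserves = λ z≢w z≢w′ → trans (adj-22 _ _ (≢-sym z≢w) (≢-sym z≢w′)) }

  ok₁ : All (y ≢_) (V cs₁)
  ok₁ = ¬Any⇒All¬ (V cs₁) avoids₁
  ok₂ : All (z ≢_) (V cs₂)
  ok₂ = ¬Any⇒All¬ (V cs₂) avoids₂

  cs₁′ cs₂′ : List (Clique n)
  cs₁′ = map (mapC φ) cs₁
  cs₂′ = map (mapC ψ) cs₂

  separated : Disjoint (V cs₁′) (V cs₂′)
  separated = subst₂ Disjoint (≡.sym (V-mapC φ cs₁)) (≡.sym (V-mapC ψ cs₂)) imagesDisjoint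
    where
    imagesDisjoint : Disjoint (map φ (V cs₁)) (map ψ (V cs₂))
    imagesDisjoint (v∈₁ , v∈₂) with ∈-map⁻ φ v∈₁ | ∈-map⁻ ψ v∈₂
    ... | u , _ , v≡φu | w , w∈ , v≡ψw = disj u w (≢-sym (All.lookup ok₂ w∈)) (trans (≡.sym v≡φu) v≡ψw)

  total : value (cs₁′ ++ cs₂′) ≡ value cs₁ + value cs₂
  total = trans (value-++ cs₁′ cs₂′) (cong₂ _+_ (value-mapC φ cs₁) (value-mapC ψ cs₂))

avoidingPacking : ∀ {n} {G : Graph n} → Ore5 n G → ∀ y → AvoidingPacking G y
avoidingPacking (k5 G complete) y = k5Avoiding G complete y
avoidingPacking (ore d₁ d₂ o)   y =
  avoidVertex (orePacking o (avoidingPacking d₁ (OreComp.y o)) (avoidingPacking d₂ (OreComp.z o))) y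

lemma1p10 : ∀ (n : ℕ) (G : Graph n) → Ore5 n G → ¬ IsK5 G →
            ∀ (t : ℕ) → IsT G t → n + 7 ≤ 4 * t
lemma1p10 n G (k5 .G complete) notK5 t _ = ⊥-elim (notK5 (refl , complete))
lemma1p10 n G (ore d₁ d₂ o) _ t (_ , maximal) =
  ≤-trans (LargePacking.bound P) (*-monoʳ-≤ 4 (maximal (LargePacking.cliques P) (LargePacking.packing P)))
  where
  P : LargePacking G
  P = orePacking o (avoidingPacking d₁ (OreComp.y o)) (avoidingPacking d₂ (OreComp.z o))
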